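{- Let $S=\langle s_0,\dots,s_{n-1}\rangle$ be a non-empty sequence of binary strings whose set $S_{\mathrm{set}}$ of distinct strings is prefix-free, and let $\mathrm{WT}(S)$ be its Wavelet Trie. Assume the node labels and the bitvectors $\beta$ stored at the internal nodes of $\mathrm{WT}(S)$ are available, with $\mathrm{Rank}$ and $\mathrm{Select}$ operations on each bitvector. Then: (1) $\mathrm{Access}(\mathrm{pos})$ can be computed using $O(h_s)$ $\mathrm{Rank}$ operations on the bitvectors, where $s=s_{\mathrm{pos}}$ is the returned string; (2) for $s\in S_{\mathrm{set}}$, $\mathrm{Rank}(s,\mathrm{pos})$ can be computed using $O(h_s)$ $\mathrm{Rank}$ operations on the bitvectors; (3) for $s\in S_{\mathrm{set}}$, $\mathrm{Select}(s,\mathrm{idx})$ can be computed using $O(h_s)$ $\mathrm{Select}$ operations on the bitvectors.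
   Context: A set of binary strings is prefix-free if no element is a proper prefix of another. The Wavelet Trie $\mathrm{WT}(S)$ of a non-empty sequence $S=\langle s_0,\dots,s_{n-1}\rangle$ of binary strings with prefix-free $S_{\mathrm{set}}$ is defined recursively: (i) if all $s_i$ equal the same string $\alpha$, $\mathrm{WT}(S)$ is a single leaf labeled $\alpha$; (ii) otherwise let $\alpha$ be the longest common prefix of the $s_i$, write $s_i=\alpha b_i\gamma_i$ with $b_i\in\{0,1\}$, let $\beta=\langle b_0,\dots,b_{n-1}\rangle$ and, for $b\in\{0,1\}$, $S_b=\langle \gamma_i : b_i=b\rangle$ (in the original order); then $\mathrm{WT}(S)$ has an internal root labeled with $\alpha$ and $\beta$, whose $0$- and $1$-labeled children are $\mathrm{WT}(S_0)$ and $\mathrm{WT}(S_1)$. The underlying tree is the Patricia trie of $S_{\mathrm{set}}$, with one leaf per element of $S_{\mathrm{set}}$. For $s\in S_{\mathrm{set}}$, $h_s$ is the number of internal nodes on the root-to-leaf path representing $s$. Operations on $S$: $\mathrm{Access}(\mathrm{pos})$ returns $s_{\mathrm{pos}}$ ($0\le \mathrm{pos}<n$); $\mathrm{Rank}(s,\mathrm{pos})$ is the number of occurrences of $s$ in $\langle s_0,\dots,s_{\mathrm{pos}-1}\rangle$; $\mathrm{Select}(s,\mathrm{idx})$ is the position of the $\mathrm{idx}$-th occurrence of $s$ in $S$. On a bitvector, $\mathrm{Rank}(b,\mathrm{pos})$ counts the bits equal to $b$ among the first $\mathrm{pos}$ positions and $\mathrm{Select}(b,\mathrm{idx})$ returns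 the position of the $\mathrm{idx}$-th bit equal to $b$. -}

module Defs where

open import Data.Bool using (Bool; true; false)
open import Data.Nat using (ℕ; zero; suc; _+_; _≤_; _<_)
open import Data.List using (List; []; _∷_; _++_; map; length; take; filter)
open import Data.List.Relation.Unary.All using (All)
open import Data.List.Membership.Propositional using (_∈_)
open import Data.Maybe using (Maybe; just; nothing)
import Data.Maybe as Maybe
open import Data.Product using (_×_; _,_; proj₁; proj₂)
open import Relation.Binary.PropositionalEquality using (_≡_; _≢_)
open import Relation.Binary.Definitions using (DecidableEquality)
open import Relation.Nullary using (yes; no)
import Data.Bool.Properties as BoolP
import Data.List.Properties as ListP

BinStr : Set
BinStr = List Bool

_≟s_ : DecidableEquality BinStr
_≟s_ = ListP.≡-dec BoolP._≟_

PrefixFree : List BinStr → Set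
PrefixFree S = ∀ x y → x ∈ S → y ∈ S → ∀ t → x ++ t ≡ y → t ≡ []

rankL : {A : Set} → DecidableEquality A → A → ℕ → List A → ℕ
rankL eq x pos xs = length (filter (eq x) (take pos xs))

-- selectL x idx xs = position of the idx-th occurrence (0-based: idx = 0 is
-- the first occurrence) of x in xs, if it exists
selectL : {A : Set} → DecidableEquality A → A → ℕ → List A → Maybe ℕ
selectL eq x idx [] = nothing
selectL eq x idx (y ∷ ys) with eq x y
selectL eq x zero    (y ∷ ys) | yes _ = just 0
selectL eq x (suc i) (y ∷ ys) | yes _ = Maybe.map suc (selectL eq x i ys)
... | no _ = Maybe.map suc (selectL eq x idx ys)

data WT : Set where
  leaf : BinStr → WT
  node : BinStr → List Bool → WT → WT → WT  -- internal node: α, β, 0-child, 1-child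

child : Bool → WT → WT → WT
child false t₀ t₁ = t₀
child true  t₀ t₁ = t₁

part : Bool → List (Bool × BinStr) → List BinStr
part b ps = map proj₂ (filter (λ p → proj₁ p BoolP.≟ b) ps)

-- In the node case, writing s_i = α b_i γ_i with both bit values occurring in β
-- is exactly saying that α is the longest common prefix and the s_i are not all equal.
data IsWT : List BinStr → WT → Set where
  leafWT : ∀ {S α} → S ≢ [] → All (_≡ α) S → IsWT S (leaf α)
  nodeWT : ∀ {S α β t₀ t₁} (ps : List (Bool × BinStr)) →
           S ≡ map (λ p → α ++ (proj₁ p ∷ proj₂ p)) ps →
           β ≡ map proj₁ ps →
           false ∈ β → true ∈ β →
           IsWT (part false ps) t₀ → IsWT (part true ps) t₁ →
           IsWT S (node α β t₀ t₁)

-- Path T s h : s is represented by a leaf of T whose root-to-leaf path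
-- contains h internal nodes (so h = h_s).
data Path : WT → BinStr → ℕ → Set where
  leafP : ∀ {α} → Path (leaf α) α 0
  nodeP : ∀ {α β t₀ t₁ b γ h} → Path (child b t₀ t₁) γ h →
          Path (node α β t₀ t₁) (α ++ (b ∷ γ)) (suc h)

-- Query model: an algorithm is a state machine that may read node labels
-- (free of charge) and perform Rank / Select operations on the bitvectors β
-- of the nodes (each counted).  Nodes are addressed by their root-to-node
-- sequence of child bits.

Addr : Set
Addr = List Bool

data NodeInfo : Set where
  leafI : BinStr → NodeInfo
  nodeI : BinStr → NodeInfo

data Action (St A : Set) : Set where
  done  : A → Action St A
  label : Addr → (Maybe NodeInfo → St) → Action St A
  rankQ : Addr → Bool → ℕ → (ℕ → St) → Action St A
  selQ  : Addr → Bool → ℕ → (Maybe ℕ → St) → Action St A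

record Algo (I A : Set) : Set₁ where
  field
    State : Set
    init  : I → State
    step  : State → Action State A
open Algo public

nodeAt : WT → Addr → Maybe WT
nodeAt t [] = just t
nodeAt (leaf _) (_ ∷ _) = nothing
nodeAt (node _ _ t₀ t₁) (b ∷ a) = nodeAt (child b t₀ t₁) a

infoOf : WT → NodeInfo
infoOf (leaf α) = leafI α
infoOf (node α _ _ _) = nodeI α

bitsAt : WT → Addr → List Bool
bitsAt t a with nodeAt t a
... | just (node _ β _ _) = β
... | _ = []

-- run fuel T A st : result, number of Rank ops, number of Select ops
-- (nothing if the fuel runs out)
runFrom : {I A : Set} → ℕ → WT → (M : Algo I A) → State M → Maybe (A × ℕ × ℕ)
runFrom zero    T M st = nothing
runFrom (suc f) T M st with step M st
... | done a = just (a , 0 , 0)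
... | label a k = runFrom f T M (k (Maybe.map infoOf (nodeAt T a)))
... | rankQ a b pos k with runFrom f T M (k (rankL BoolP._≟_ b pos (bitsAt T a)))
...   | just (x , r , q) = just (x , suc r , q)
...   | nothing = nothing
runFrom (suc f) T M st | selQ a b idx k with runFrom f T M (k (selectL BoolP._≟_ b idx (bitsAt T a)))
...   | just (x , r , q) = just (x , r , suc q)
...   | nothing = nothing

run : {I A : Set} → ℕ → WT → Algo I A → I → Maybe (A × ℕ × ℕ)
run f T M i = runFrom f T M (init M i)

-- At an internal node with label α and bitvector β, the occurrences of s = α b γ in S are exactly
-- the positions of β holding b, and they correspond in order to the occurrences of γ in S_b.
-- Hence Rank(s, pos) = Rank_{S_b}(γ, Rank_β(b, pos)) and Select(s, i) = Select_β(b, Select_{S_b}(γ, i)),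
-- so Rank descends the path of s with one bitvector Rank per node, and Select descends to the leaf
-- and then climbs back with one bitvector Select per node.  Access descends too, reading the bit
-- β[pos] off two Rank(1, ·) queries and moving to position Rank_β(β[pos], pos) of the child.
module Submission where

open import Defs
open import Data.Bool using (Bool; true; false; not)
open import Data.Bool.Properties using () renaming (_≟_ to _≟b_)
open import Data.Nat using (ℕ; zero; suc; _+_; _*_; _≤_; _<_; _≡ᵇ_; z≤n; s≤s)
open import Data.Nat.Properties using (≤-refl; ≤-trans; n≤1+n; m≤n*m; *-monoʳ-≤; +-suc; *-suc)
open import Data.List using (List; []; _∷_; _++_; [_]; map; length; lookup; drop; filter)
open import Data.List.Properties using (∷-injective; ++-cancelˡ; ++-assoc; take-all; length-map)
open import Data.List.Relation.Unary.All using (All; _∷_)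
open import Data.List.Membership.Propositional using (_∈_)
open import Data.Fin using (fromℕ<)
open import Data.Maybe using (Maybe; just; nothing; fromMaybe)
import Data.Maybe as Maybe
open import Data.Maybe.Properties using (just-injective)
open import Data.Product using (Σ; ∃; _×_; _,_; proj₁; proj₂)
open import Relation.Binary.PropositionalEquality using (_≡_; _≢_; refl; sym; trans; cong; cong₂; subst; subst₂; module ≡-Reasoning)
open import Relation.Binary.Definitions using (DecidableEquality)
open import Relation.Nullary using (yes; no; contradiction)

lookup? : {A : Set} → List A → ℕ → Maybe A
lookup? []       _       = nothing
lookup? (x ∷ xs) zero    = just x
lookup? (x ∷ xs) (suc n) = lookup? xs n

lookup?-lookup : {A : Set} (xs : List A) (pos : ℕ) (lt : pos < length xs) →
                 lookup? xs pos ≡ just (lookup xs (fromℕ< lt))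
lookup?-lookup (x ∷ xs) zero    _        = refl
lookup?-lookup (x ∷ xs) (suc n) (s≤s lt) = lookup?-lookup xs n lt

lookup?-map : {A B : Set} (f : A → B) (xs : List A) (pos : ℕ) →
              lookup? (map f xs) pos ≡ Maybe.map f (lookup? xs pos)
lookup?-map f []       _         = refl
lookup?-map f (x ∷ xs) zero      = refl
lookup?-map f (x ∷ xs) (suc pos) = lookup?-map f xs pos

drop-length-++ : {A : Set} (xs ys : List A) → drop (length xs) (xs ++ ys) ≡ ys
drop-length-++ []       ys = refl
drop-length-++ (x ∷ xs) ys = drop-length-++ xs ys

map-suc≡just : (m : Maybe ℕ) {j : ℕ} → Maybe.map suc m ≡ just j → ∃ λ j′ → m ≡ just j′ × j ≡ suc j′
map-suc≡just (just j′) refl = j′ , refl , refl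

module _ {A : Set} (_≟_ : DecidableEquality A) where

  rankL-length : ∀ x xs → rankL _≟_ x (length xs) xs ≡ length (filter (x ≟_) xs)
  rankL-length x xs = cong (λ ys → length (filter (x ≟_) ys)) (take-all (length xs) xs ≤-refl)

  rankL-all : ∀ {x} xs pos → All (_≡ x) xs → pos ≤ length xs → rankL _≟_ x pos xs ≡ pos
  rankL-all xs zero _ _ = refl
  rankL-all {x} (_ ∷ xs) (suc pos) (refl ∷ all) (s≤s pos≤) with x ≟ x
  ... | yes _   = cong suc (rankL-all xs pos all pos≤)
  ... | no x≢x = contradiction refl x≢x

  selectL-all : ∀ {x} xs idx → All (_≡ x) xs → idx < length xs → selectL _≟_ x idx xs ≡ just idx
  selectL-all {x} (_ ∷ xs) idx (refl ∷ all) idx< with x ≟ x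
  selectL-all (_ ∷ xs) zero      (refl ∷ all) _          | yes _ = refl
  selectL-all (_ ∷ xs) (suc idx) (refl ∷ all) (s≤s idx<) | yes _ =
    cong (Maybe.map suc) (selectL-all xs idx all idx<)
  ... | no x≢x = contradiction refl x≢x

  selectL-defined : ∀ x xs idx → idx < rankL _≟_ x (length xs) xs → ∃ λ p → selectL _≟_ x idx xs ≡ just p
  selectL-defined x xs idx idx< = go xs idx (subst (idx <_) (rankL-length x xs) idx<)
    where
    go : ∀ xs idx → idx < length (filter (x ≟_) xs) → ∃ λ p → selectL _≟_ x idx xs ≡ just p
    go (y ∷ ys) idx idx< with x ≟ y
    go (y ∷ ys) zero      _          | yes _ = 0 , refl
    go (y ∷ ys) (suc idx) (s≤s idx<) | yes _ with go ys idx idx<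
    ... | p , sel = suc p , cong (Maybe.map suc) sel
    go (y ∷ ys) idx idx< | no _ with go ys idx idx<
    ... | p , sel = suc p , cong (Maybe.map suc) sel

readBit : ℕ → ℕ → Bool
readBit ones ones′ = not (ones ≡ᵇ ones′)

readBit-rank : ∀ β pos {b} → lookup? β pos ≡ just b →
               readBit (rankL _≟b_ true pos β) (rankL _≟b_ true (suc pos) β) ≡ b
readBit-rank (true  ∷ β) zero      refl = refl
readBit-rank (false ∷ β) zero      refl = refl
readBit-rank (true  ∷ β) (suc pos) bit  = readBit-rank β pos bit
readBit-rank (false ∷ β) (suc pos) bit  = readBit-rank β pos bit

branch : BinStr → Bool × BinStr → BinStr
branch α (b , γ) = α ++ b ∷ γ

branch-injective : ∀ (α : BinStr) {b b′ : Bool} {γ γ′ : BinStr} → α ++ b ∷ γ ≡ α ++ b′ ∷ γ′ → b ≡ b′ × γ ≡ γ′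
branch-injective α eq = ∷-injective (++-cancelˡ α _ _ eq)

lookup?-branch : ∀ α (ps : List (Bool × BinStr)) pos {b γ} → lookup? (map (branch α) ps) pos ≡ just (α ++ b ∷ γ) →
                 lookup? ps pos ≡ just (b , γ)
lookup?-branch α (_ ∷ ps) zero eq =
  let b′≡b , γ′≡γ = branch-injective α (just-injective eq) in cong just (cong₂ _,_ b′≡b γ′≡γ)
lookup?-branch α (_ ∷ ps) (suc pos) eq = lookup?-branch α ps pos eq

lookup?-part : ∀ (ps : List (Bool × BinStr)) pos {b γ} → lookup? ps pos ≡ just (b , γ) →
               lookup? (part b ps) (rankL _≟b_ b pos (map proj₁ ps)) ≡ just γ
lookup?-part ((true  , _) ∷ ps) zero refl = refl
lookup?-part ((false , _) ∷ ps) zero refl = refl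
lookup?-part ((true  , _) ∷ ps) (suc pos) {true}  look = lookup?-part ps pos look
lookup?-part ((true  , _) ∷ ps) (suc pos) {false} look = lookup?-part ps pos look
lookup?-part ((false , _) ∷ ps) (suc pos) {true}  look = lookup?-part ps pos look
lookup?-part ((false , _) ∷ ps) (suc pos) {false} look = lookup?-part ps pos look

rank-bits-≤ : ∀ b (ps : List (Bool × BinStr)) pos → rankL _≟b_ b pos (map proj₁ ps) ≤ length (part b ps)
rank-bits-≤ b     ps                 zero      = z≤n
rank-bits-≤ b     []                 (suc pos) = z≤n
rank-bits-≤ true  ((true  , _) ∷ ps) (suc pos) = s≤s (rank-bits-≤ true ps pos)
rank-bits-≤ true  ((false , _) ∷ ps) (suc pos) = rank-bits-≤ true ps pos
rank-bits-≤ false ((true  , _) ∷ ps) (suc pos) = rank-bits-≤ false ps pos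
rank-bits-≤ false ((false , _) ∷ ps) (suc pos) = s≤s (rank-bits-≤ false ps pos)

rank-bits-length : ∀ b (ps : List (Bool × BinStr)) →
                   rankL _≟b_ b (length ps) (map proj₁ ps) ≡ length (part b ps)
rank-bits-length b     []                 = refl
rank-bits-length true  ((true  , _) ∷ ps) = cong suc (rank-bits-length true ps)
rank-bits-length true  ((false , _) ∷ ps) = rank-bits-length true ps
rank-bits-length false ((true  , _) ∷ ps) = rank-bits-length false ps
rank-bits-length false ((false , _) ∷ ps) = cong suc (rank-bits-length false ps)

rank-branch-same : ∀ (α : BinStr) b γ γ′ xs L {pos r} →
  rankL _≟s_ (α ++ b ∷ γ) pos xs ≡ rankL _≟s_ γ r L →
  rankL _≟s_ (α ++ b ∷ γ) (suc pos) ((α ++ b ∷ γ′) ∷ xs) ≡ rankL _≟s_ γ (suc r) (γ′ ∷ L)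
rank-branch-same α b γ γ′ xs L ih with γ ≟s γ′ | (α ++ b ∷ γ) ≟s (α ++ b ∷ γ′)
... | yes refl   | yes _    = cong suc ih
... | yes refl   | no s≢s   = contradiction refl s≢s
... | no γ≢γ′    | yes s≡s′ = contradiction (proj₂ (branch-injective α s≡s′)) γ≢γ′
... | no _       | no _     = ih

rank-branch-other : ∀ (α : BinStr) {b b′ : Bool} γ γ′ xs {pos} → b ≢ b′ →
  rankL _≟s_ (α ++ b ∷ γ) (suc pos) ((α ++ b′ ∷ γ′) ∷ xs) ≡ rankL _≟s_ (α ++ b ∷ γ) pos xs
rank-branch-other α {b} {b′} γ γ′ xs b≢b′ with (α ++ b ∷ γ) ≟s (α ++ b′ ∷ γ′)
... | yes s≡s′ = contradiction (proj₁ (branch-injective α s≡s′)) b≢b′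
... | no _     = refl

rank-branch : ∀ (α : BinStr) b γ (ps : List (Bool × BinStr)) pos →
  rankL _≟s_ (α ++ b ∷ γ) pos (map (branch α) ps) ≡
  rankL _≟s_ γ (rankL _≟b_ b pos (map proj₁ ps)) (part b ps)
rank-branch α b     γ []                  zero      = refl
rank-branch α b     γ []                  (suc pos) = refl
rank-branch α b     γ (_ ∷ _)             zero      = refl
rank-branch α true  γ ((true  , γ′) ∷ ps) (suc pos) =
  rank-branch-same α true γ γ′ _ _ (rank-branch α true γ ps pos)
rank-branch α false γ ((false , γ′) ∷ ps) (suc pos) =
  rank-branch-same α false γ γ′ _ _ (rank-branch α false γ ps pos)
rank-branch α true  γ ((false , γ′) ∷ ps) (suc pos) =
  trans (rank-branch-other α γ γ′ _ λ ()) (rank-branch α true γ ps pos)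
rank-branch α false γ ((true  , γ′) ∷ ps) (suc pos) =
  trans (rank-branch-other α γ γ′ _ λ ()) (rank-branch α false γ ps pos)

rank-branch-length : ∀ (α : BinStr) b γ (ps : List (Bool × BinStr)) →
  rankL _≟s_ (α ++ b ∷ γ) (length (map (branch α) ps)) (map (branch α) ps) ≡
  rankL _≟s_ γ (length (part b ps)) (part b ps)
rank-branch-length α b γ ps = begin
  rankL _≟s_ (α ++ b ∷ γ) (length (map (branch α) ps)) (map (branch α) ps)
    ≡⟨ rank-branch α b γ ps (length (map (branch α) ps)) ⟩
  rankL _≟s_ γ (rankL _≟b_ b (length (map (branch α) ps)) (map proj₁ ps)) (part b ps)
    ≡⟨ cong (λ n → rankL _≟s_ γ (rankL _≟b_ b n (map proj₁ ps)) (part b ps)) (length-map (branch α) ps) ⟩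
  rankL _≟s_ γ (rankL _≟b_ b (length ps) (map proj₁ ps)) (part b ps)
    ≡⟨ cong (λ n → rankL _≟s_ γ n (part b ps)) (rank-bits-length b ps) ⟩
  rankL _≟s_ γ (length (part b ps)) (part b ps)
    ∎
  where open ≡-Reasoning

select-branch-same : ∀ (α : BinStr) b γ γ′ xs L β →
  (∀ {idx j} → selectL _≟s_ γ idx L ≡ just j →
     selectL _≟s_ (α ++ b ∷ γ) idx xs ≡ selectL _≟b_ b j β) →
  ∀ {idx j} → selectL _≟s_ γ idx (γ′ ∷ L) ≡ just j →
  selectL _≟s_ (α ++ b ∷ γ) idx ((α ++ b ∷ γ′) ∷ xs) ≡ selectL _≟b_ b j (b ∷ β)
select-branch-same α b γ γ′ xs L β ih {idx} sel
  with γ ≟s γ′ | (α ++ b ∷ γ) ≟s (α ++ b ∷ γ′) | b ≟b b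
... | _       | _        | no b≢b   = contradiction refl b≢b
... | yes refl | no s≢s   | _       = contradiction refl s≢s
... | no γ≢γ′ | yes s≡s′ | _       = contradiction (proj₂ (branch-injective α s≡s′)) γ≢γ′
select-branch-same α b γ γ′ xs L β ih {zero}    refl | yes refl | yes _ | yes _ = refl
select-branch-same α b γ γ′ xs L β ih {suc idx} sel  | yes refl | yes _ | yes _
  with map-suc≡just (selectL _≟s_ γ idx L) sel
... | j′ , sel′ , refl = cong (Maybe.map suc) (ih sel′)
select-branch-same α b γ γ′ xs L β ih {idx} sel | no _ | no _ | yes _
  with map-suc≡just (selectL _≟s_ γ idx L) sel
... | j′ , sel′ , refl = cong (Maybe.map suc) (ih sel′)

select-branch-other : ∀ (α : BinStr) {b b′ : Bool} γ γ′ xs β {idx j} → b ≢ b′ →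
  selectL _≟s_ (α ++ b ∷ γ) idx xs ≡ selectL _≟b_ b j β →
  selectL _≟s_ (α ++ b ∷ γ) idx ((α ++ b′ ∷ γ′) ∷ xs) ≡ selectL _≟b_ b j (b′ ∷ β)
select-branch-other α {b} {b′} γ γ′ xs β b≢b′ ih with (α ++ b ∷ γ) ≟s (α ++ b′ ∷ γ′) | b ≟b b′
... | yes s≡s′ | _      = contradiction (proj₁ (branch-injective α s≡s′)) b≢b′
... | _        | yes b≡b′ = contradiction b≡b′ b≢b′
... | no _     | no _   = cong (Maybe.map suc) ih

select-branch : ∀ (α : BinStr) b γ (ps : List (Bool × BinStr)) {idx j} →
  selectL _≟s_ γ idx (part b ps) ≡ just j →
  selectL _≟s_ (α ++ b ∷ γ) idx (map (branch α) ps) ≡ selectL _≟b_ b j (map proj₁ ps)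
select-branch α b     γ []                  ()
select-branch α true  γ ((true  , γ′) ∷ ps) sel =
  select-branch-same α true γ γ′ _ _ _ (select-branch α true γ ps) sel
select-branch α false γ ((false , γ′) ∷ ps) sel =
  select-branch-same α false γ γ′ _ _ _ (select-branch α false γ ps) sel
select-branch α true  γ ((false , γ′) ∷ ps) sel =
  select-branch-other α γ γ′ _ (map proj₁ ps) (λ ()) (select-branch α true γ ps sel)
select-branch α false γ ((true  , γ′) ∷ ps) sel =
  select-branch-other α γ γ′ _ (map proj₁ ps) (λ ()) (select-branch α false γ ps sel)

nodeAt-++ : ∀ T a {t} a′ → nodeAt T a ≡ just t → nodeAt T (a ++ a′) ≡ nodeAt t a′
nodeAt-++ T                [] a′ refl = refl
nodeAt-++ (node _ _ t₀ t₁) (b ∷ a) a′ eq = nodeAt-++ (child b t₀ t₁) a a′ eq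

bitsAt-node : ∀ T a {α β t₀ t₁} → nodeAt T a ≡ just (node α β t₀ t₁) → bitsAt T a ≡ β
bitsAt-node T a eq rewrite eq = refl

-- A fuel-free big-step semantics of runFrom, so that runs compose without fuel arithmetic.
module Execution {I A : Set} (M : Algo I A) where

  data Eval (T : WT) : Action (State M) A → A × ℕ × ℕ → Set where
    ⇓-done   : ∀ {x} → Eval T (done x) (x , 0 , 0)
    ⇓-label  : ∀ {a k v} → Eval T (step M (k (Maybe.map infoOf (nodeAt T a)))) v → Eval T (label a k) v
    ⇓-rank   : ∀ {a b pos k x r q} → Eval T (step M (k (rankL _≟b_ b pos (bitsAt T a)))) (x , r , q) →
               Eval T (rankQ a b pos k) (x , suc r , q)
    ⇓-select : ∀ {a b idx k x r q} → Eval T (step M (k (selectL _≟b_ b idx (bitsAt T a)))) (x , r , q) →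
               Eval T (selQ a b idx k) (x , r , suc q)

  infix 4 _⊢_⇓_
  _⊢_⇓_ : WT → State M → A × ℕ × ℕ → Set
  T ⊢ st ⇓ v = Eval T (step M st) v

  runFrom-done : ∀ {T st x} → step M st ≡ done x → runFrom 1 T M st ≡ just (x , 0 , 0)
  runFrom-done eq rewrite eq = refl

  runFrom-label : ∀ {T st a k f v} → step M st ≡ label a k →
    runFrom f T M (k (Maybe.map infoOf (nodeAt T a))) ≡ just v → runFrom (suc f) T M st ≡ just v
  runFrom-label eq run rewrite eq = run

  runFrom-rankQ : ∀ {T st a b pos k f x r q} → step M st ≡ rankQ a b pos k →
    runFrom f T M (k (rankL _≟b_ b pos (bitsAt T a))) ≡ just (x , r , q) →
    runFrom (suc f) T M st ≡ just (x , suc r , q)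
  runFrom-rankQ eq run rewrite eq | run = refl

  runFrom-selQ : ∀ {T st a b idx k f x r q} → step M st ≡ selQ a b idx k →
    runFrom f T M (k (selectL _≟b_ b idx (bitsAt T a))) ≡ just (x , r , q) →
    runFrom (suc f) T M st ≡ just (x , r , suc q)
  runFrom-selQ eq run rewrite eq | run = refl

  ⇓-runFrom : ∀ {T st v} → T ⊢ st ⇓ v → ∃ λ fuel → runFrom fuel T M st ≡ just v
  ⇓-runFrom = go refl
    where
    go : ∀ {T st act v} → step M st ≡ act → Eval T act v → ∃ λ fuel → runFrom fuel T M st ≡ just v
    go eq ⇓-done       = 1 , runFrom-done eq
    go eq (⇓-label e)  = let fuel , run = go refl e in suc fuel , runFrom-label eq run
    go eq (⇓-rank e)   = let fuel , run = go refl e in suc fuel , runFrom-rankQ eq run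
    go eq (⇓-select e) = let fuel , run = go refl e in suc fuel , runFrom-selQ eq run

  ⇓-label-at : ∀ {T a t k v} → nodeAt T a ≡ just t → T ⊢ k (just (infoOf t)) ⇓ v → Eval T (label a k) v
  ⇓-label-at {T} {k = k} {v} eq e = ⇓-label (subst (λ m → T ⊢ k (Maybe.map infoOf m) ⇓ v) (sym eq) e)

  ⇓-rank-at : ∀ {T a α β t₀ t₁ b pos k x r q} → nodeAt T a ≡ just (node α β t₀ t₁) →
    T ⊢ k (rankL _≟b_ b pos β) ⇓ (x , r , q) → Eval T (rankQ a b pos k) (x , suc r , q)
  ⇓-rank-at {T} {a} {b = b} {pos} {k} {x} {r} {q} eq e =
    ⇓-rank (subst (λ β → T ⊢ k (rankL _≟b_ b pos β) ⇓ (x , r , q)) (sym (bitsAt-node T a eq)) e)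

  ⇓-select-at : ∀ {T a α β t₀ t₁ b idx k x r q} → nodeAt T a ≡ just (node α β t₀ t₁) →
    T ⊢ k (selectL _≟b_ b idx β) ⇓ (x , r , q) → Eval T (selQ a b idx k) (x , r , suc q)
  ⇓-select-at {T} {a} {b = b} {idx} {k} {x} {r} {q} eq e =
    ⇓-select (subst (λ β → T ⊢ k (selectL _≟b_ b idx β) ⇓ (x , r , q)) (sym (bitsAt-node T a eq)) e)

module Rank where

  data Config : Set where
    visit   : Addr → BinStr → ℕ → Config
    arrived : Addr → BinStr → ℕ → Maybe NodeInfo → Config

  descend : Addr → ℕ → BinStr → Action Config ℕ
  descend a pos []      = done 0
  descend a pos (b ∷ γ) = rankQ a b pos (visit (a ++ [ b ]) γ)

  transition : Config → Action Config ℕ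
  transition (visit a s pos)                    = label a (arrived a s pos)
  transition (arrived a s pos (just (leafI _))) = done pos
  transition (arrived a s pos (just (nodeI α))) = descend a pos (drop (length α) s)
  transition (arrived _ _ _ nothing)            = done 0

  algorithm : Algo (BinStr × ℕ) ℕ
  algorithm = record { State = Config ; init = λ (s , pos) → visit [] s pos ; step = transition }

  open Execution algorithm

  Correct : List BinStr → WT → Set
  Correct S t = ∀ {T a} → nodeAt T a ≡ just t → ∀ {s h} → Path t s h →
                ∀ pos → pos ≤ length S → T ⊢ visit a s pos ⇓ (rankL _≟s_ s pos S , h , 0)

  visit-node : ∀ {T a α β t₀ t₁ b γ pos x r} → nodeAt T a ≡ just (node α β t₀ t₁) →
    T ⊢ visit (a ++ [ b ]) γ (rankL _≟b_ b pos β) ⇓ (x , r , 0) →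
    T ⊢ visit a (α ++ b ∷ γ) pos ⇓ (x , suc r , 0)
  visit-node {T} {a} {α} {b = b} {γ} {pos} eq e =
    ⇓-label-at eq (subst (λ s → Eval T (descend a pos s) _) (sym (drop-length-++ α (b ∷ γ))) (⇓-rank-at eq e))

  correct-node : ∀ {α t₀ t₁} ps → (∀ b → Correct (part b ps) (child b t₀ t₁)) →
                 Correct (map (branch α) ps) (node α (map proj₁ ps) t₀ t₁)
  correct-node {α} ps child-correct {T} {a} eq (nodeP {b = b} {γ} {h} path) pos _ =
    subst (λ n → T ⊢ visit a (α ++ b ∷ γ) pos ⇓ (n , suc h , 0)) (sym (rank-branch α b γ ps pos))
      (visit-node eq (child-correct b (nodeAt-++ T a [ b ] eq) path _ (rank-bits-≤ b ps pos)))

  correct : ∀ {S t} → IsWT S t → Correct S t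
  correct (leafWT _ all) {T} {a} eq {α} leafP pos pos≤ =
    subst (λ n → T ⊢ visit a α pos ⇓ (n , 0 , 0)) (sym (rankL-all _≟s_ _ pos all pos≤)) (⇓-label-at eq ⇓-done)
  correct (nodeWT ps refl refl _ _ w₀ w₁) = correct-node ps λ { false → correct w₀ ; true → correct w₁ }

  computes-rank : ∀ (S : List BinStr) (T : WT) → IsWT S T → ∀ s pos → pos ≤ length S → ∀ h → Path T s h →
    ∃ λ fuel → ∃ λ r → run fuel T algorithm (s , pos) ≡ just (rankL _≟s_ s pos S , r , 0) × r ≤ 1 * suc h
  computes-rank S T w s pos pos≤ h path =
    let fuel , run≡ = ⇓-runFrom {st = visit [] s pos} (correct w refl path pos pos≤)
    in fuel , h , run≡ , ≤-trans (n≤1+n h) (m≤n*m (suc h) 1)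

module Access where

  -- acc holds the labels and branch bits read on the way from the root to the current node.
  data Config : Set where
    visit   : Addr → BinStr → ℕ → Config
    arrived : Addr → BinStr → ℕ → Maybe NodeInfo → Config
    counted : Addr → BinStr → ℕ → ℕ → Config
    descend : Addr → BinStr → ℕ → Bool → Config

  transition : Config → Action Config BinStr
  transition (visit a acc pos)                    = label a (arrived a acc pos)
  transition (arrived a acc pos (just (leafI α))) = done (acc ++ α)
  transition (arrived a acc pos (just (nodeI α))) = rankQ a true pos (counted a (acc ++ α) pos)
  transition (arrived _ _ _ nothing)              = done []
  transition (counted a acc pos ones)             =
    rankQ a true (suc pos) λ ones′ → descend a acc pos (readBit ones ones′)
  transition (descend a acc pos b)                = rankQ a b pos (visit (a ++ [ b ]) (acc ++ [ b ]))

  algorithm : Algo ℕ BinStr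
  algorithm = record { State = Config ; init = visit [] [] ; step = transition }

  open Execution algorithm

  Correct : List BinStr → WT → Set
  Correct S t = ∀ {T a} → nodeAt T a ≡ just t → ∀ {s h} → Path t s h →
                ∀ acc pos → lookup? S pos ≡ just s → T ⊢ visit a acc pos ⇓ (acc ++ s , 3 * h , 0)

  visit-node : ∀ {T a α β t₀ t₁ b acc pos x r} → nodeAt T a ≡ just (node α β t₀ t₁) → lookup? β pos ≡ just b →
    T ⊢ visit (a ++ [ b ]) ((acc ++ α) ++ [ b ]) (rankL _≟b_ b pos β) ⇓ (x , r , 0) →
    T ⊢ visit a acc pos ⇓ (x , 3 + r , 0)
  visit-node {T} {a} {α} {β} {acc = acc} {pos} {x} {r} eq bit e =
    ⇓-label-at eq (⇓-rank-at eq (⇓-rank-at eq (⇓-rank-at eq (subst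
      (λ c → T ⊢ visit (a ++ [ c ]) ((acc ++ α) ++ [ c ]) (rankL _≟b_ c pos β) ⇓ (x , r , 0))
      (sym (readBit-rank β pos bit)) e))))

  correct-node : ∀ {α t₀ t₁} ps → (∀ b → Correct (part b ps) (child b t₀ t₁)) →
                 Correct (map (branch α) ps) (node α (map proj₁ ps) t₀ t₁)
  correct-node {α} ps child-correct {T} {a} eq (nodeP {b = b} {γ} {h} path) acc pos look =
    subst₂ (λ s c → T ⊢ visit a acc pos ⇓ (s , c , 0))
      (trans (++-assoc (acc ++ α) [ b ] γ) (++-assoc acc α (b ∷ γ))) (sym (*-suc 3 h))
      (visit-node eq bit (child-correct b (nodeAt-++ T a [ b ] eq) path _ _ (lookup?-part ps pos look′)))
    where
    look′ : lookup? ps pos ≡ just (b , γ)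
    look′ = lookup?-branch α ps pos look
    bit : lookup? (map proj₁ ps) pos ≡ just b
    bit = trans (lookup?-map proj₁ ps pos) (cong (Maybe.map proj₁) look′)

  correct : ∀ {S t} → IsWT S t → Correct S t
  correct (leafWT _ _) eq leafP acc pos _ = ⇓-label-at eq ⇓-done
  correct (nodeWT ps refl refl _ _ w₀ w₁) = correct-node ps λ { false → correct w₀ ; true → correct w₁ }

  computes-access : ∀ (S : List BinStr) (T : WT) → IsWT S T →
    ∀ pos → (lt : pos < length S) → ∀ h → Path T (lookup S (fromℕ< lt)) h →
    ∃ λ fuel → ∃ λ r → run fuel T algorithm pos ≡ just (lookup S (fromℕ< lt) , r , 0) × r ≤ 3 * suc h
  computes-access S T w pos lt h path =
    let fuel , run≡ = ⇓-runFrom {st = visit [] [] pos} (correct w refl path [] pos (lookup?-lookup S pos lt))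
    in fuel , 3 * h , run≡ , *-monoʳ-≤ 3 (n≤1+n h)

module Select where

  -- The stack holds the nodes passed on the way down, each with the branch taken there.
  data Config : Set where
    visit   : Addr → BinStr → List (Addr × Bool) → ℕ → Config
    arrived : Addr → BinStr → List (Addr × Bool) → ℕ → Maybe NodeInfo → Config
    ascend  : List (Addr × Bool) → ℕ → Config

  climb : List (Addr × Bool) → ℕ → Action Config ℕ
  climb []              idx = done idx
  climb ((a , b) ∷ stk) idx = selQ a b idx (λ p → ascend stk (fromMaybe 0 p))

  descend : Addr → List (Addr × Bool) → ℕ → BinStr → Action Config ℕ
  descend a stk idx []      = done 0
  descend a stk idx (b ∷ γ) = label (a ++ [ b ]) (arrived (a ++ [ b ]) γ ((a , b) ∷ stk) idx)

  transition : Config → Action Config ℕ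
  transition (visit a s stk idx)                    = label a (arrived a s stk idx)
  transition (arrived a s stk idx (just (leafI _))) = climb stk idx
  transition (arrived a s stk idx (just (nodeI α))) = descend a stk idx (drop (length α) s)
  transition (arrived _ _ _ _ nothing)              = done 0
  transition (ascend stk idx)                       = climb stk idx

  algorithm : Algo (BinStr × ℕ) ℕ
  algorithm = record { State = Config ; init = λ (s , idx) → visit [] s [] idx ; step = transition }

  open Execution algorithm

  Correct : List BinStr → WT → Set
  Correct S t = ∀ {T a} → nodeAt T a ≡ just t → ∀ {s h} → Path t s h →
    ∀ idx → idx < rankL _≟s_ s (length S) S → ∃ λ p → selectL _≟s_ s idx S ≡ just p ×
    (∀ {stk x r q} → T ⊢ ascend stk p ⇓ (x , r , q) → T ⊢ visit a s stk idx ⇓ (x , r , h + q))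

  visit-node : ∀ {T a α β t₀ t₁ b γ stk idx v} → nodeAt T a ≡ just (node α β t₀ t₁) →
    T ⊢ visit (a ++ [ b ]) γ ((a , b) ∷ stk) idx ⇓ v → T ⊢ visit a (α ++ b ∷ γ) stk idx ⇓ v
  visit-node {T} {a} {α} {b = b} {γ} {stk} {idx} {v} eq e =
    ⇓-label-at eq (subst (λ s → Eval T (descend a stk idx s) v) (sym (drop-length-++ α (b ∷ γ))) e)

  ascend-node : ∀ {T a α β t₀ t₁ b stk j p x r q} → nodeAt T a ≡ just (node α β t₀ t₁) →
    selectL _≟b_ b j β ≡ just p → T ⊢ ascend stk p ⇓ (x , r , q) → T ⊢ ascend ((a , b) ∷ stk) j ⇓ (x , r , suc q)
  ascend-node {T} {stk = stk} {x = x} {r} {q} eq sel e =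
    ⇓-select-at eq (subst (λ m → T ⊢ ascend stk (fromMaybe 0 m) ⇓ (x , r , q)) (sym sel) e)

  correct-node : ∀ {α t₀ t₁} ps → (∀ b → Correct (part b ps) (child b t₀ t₁)) →
                 Correct (map (branch α) ps) (node α (map proj₁ ps) t₀ t₁)
  correct-node {α} ps child-correct {T} {a} eq (nodeP {b = b} {γ} {h} path) idx idx<
    with child-correct b (nodeAt-++ T a [ b ] eq) path idx (subst (idx <_) (rank-branch-length α b γ ps) idx<)
       | selectL-defined _≟s_ (α ++ b ∷ γ) (map (branch α) ps) idx idx<
  ... | j , sel-child , climb-child | p , sel =
    p , sel , λ {stk} {x} {r} {q} e → visit-node eq
      (subst (λ c → T ⊢ visit (a ++ [ b ]) γ ((a , b) ∷ stk) idx ⇓ (x , r , c)) (+-suc h q)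
        (climb-child (ascend-node eq (trans (sym (select-branch α b γ ps sel-child)) sel) e)))

  correct : ∀ {S t} → IsWT S t → Correct S t
  correct (leafWT _ all) eq leafP idx idx< =
    idx , selectL-all _≟s_ _ idx all (subst (idx <_) (rankL-all _≟s_ _ _ all ≤-refl) idx<) , ⇓-label-at eq
  correct (nodeWT ps refl refl _ _ w₀ w₁) = correct-node ps λ { false → correct w₀ ; true → correct w₁ }

  computes-select : ∀ (S : List BinStr) (T : WT) → IsWT S T →
    ∀ s idx → idx < rankL _≟s_ s (length S) S → ∀ h → Path T s h →
    ∃ λ p → selectL _≟s_ s idx S ≡ just p ×
    ∃ λ fuel → ∃ λ q → run fuel T algorithm (s , idx) ≡ just (p , 0 , q) × q ≤ 1 * suc h
  computes-select S T w s idx idx< h path =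
    let p , sel , climb-root = correct w refl path idx idx<
        fuel , run≡ = ⇓-runFrom {st = visit [] s [] idx} (climb-root ⇓-done)
    in p , sel , fuel , h + 0 , run≡ , n≤1+n (h + 0)

lemma1 :
    (Σ (Algo ℕ BinStr) λ M → Σ ℕ λ c →
      ∀ (S : List BinStr) (T : WT) → S ≢ [] → PrefixFree S → IsWT S T →
      ∀ pos → (lt : pos < length S) → ∀ h → Path T (lookup S (fromℕ< lt)) h →
      ∃ λ fuel → ∃ λ r →
        run fuel T M pos ≡ just (lookup S (fromℕ< lt) , r , 0) × r ≤ c * suc h)
    ×
    (Σ (Algo (BinStr × ℕ) ℕ) λ M → Σ ℕ λ c →
      ∀ (S : List BinStr) (T : WT) → S ≢ [] → PrefixFree S → IsWT S T →
      ∀ s pos → s ∈ S → pos ≤ length S → ∀ h → Path T s h →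
      ∃ λ fuel → ∃ λ r →
        run fuel T M (s , pos) ≡ just (rankL _≟s_ s pos S , r , 0) × r ≤ c * suc h)
    ×
    (Σ (Algo (BinStr × ℕ) ℕ) λ M → Σ ℕ λ c →
      ∀ (S : List BinStr) (T : WT) → S ≢ [] → PrefixFree S → IsWT S T →
      ∀ s idx → s ∈ S → idx < rankL _≟s_ s (length S) S → ∀ h → Path T s h →
      ∃ λ p → selectL _≟s_ s idx S ≡ just p ×
      ∃ λ fuel → ∃ λ q →
        run fuel T M (s , idx) ≡ just (p , 0 , q) × q ≤ c * suc h)
lemma1 =
    (Access.algorithm , 3 , λ S T _ _ → Access.computes-access S T)
  , (Rank.algorithm   , 1 , λ S T _ _ w s pos _ → Rank.computes-rank S T w s pos)
  , (Select.algorithm , 1 , λ S T _ _ w s idx _ → Select.computes-select S T w s idx)
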